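{- Let $D\ge2$ and let $\mathcal{M}\in\mathbb{M}_0$ be an edge-colored map without cilia. Then its power $\delta(\mathcal{M})=\mathcal{F}(\mathcal{M})-(D-1)\mathcal{E}(\mathcal{M})$ satisfies $$\delta(\mathcal{M}) = D\bigl(1-l(\mathcal{M})\bigr)+2\sum_{i=1}^D\bigl(l(\mathcal{M}^{(i)})-g(\mathcal{M}^{(i)})\bigr).$$
   Context: Write $[D]=\{1,\dots,D\}$. An edge-colored map is a connected combinatorial map (graph with rotation system; loops and multiple edges allowed) whose edges each carry a color in $[D]$ (coloring not necessarily proper); $\mathbb{M}_0$ is the set of such maps without cilia. $\mathcal{E}(\mathcal{M})$ is the number of edges. For $i\in[D]$ the monochromatic submap $\mathcal{M}^{(i)}$ is obtained by deleting all edges not of color $i$, keeping all vertices; $\mathcal{F}(\mathcal{M})=\sum_{i=1}^D\mathcal{F}(\mathcal{M}^{(i)})$, where $\mathcal{F}(\mathcal{M}^{(i)})$ is the number of faces of all connected components of $\mathcal{M}^{(i)}$ (an isolated vertex counting as one face). For a map with $\mathcal{V}$ vertices, $\mathcal{E}$ edges, $\mathcal{F}$ faces and $k$ components, the circuit rank is $l=\mathcal{E}-\mathcal{V}+k$ (so $l(\mathcal{M})=\mathcal{E}-\mathcal{V}+1$) and the genus $g$ is defined by $\mathcal{F}=2k-2g+\mathcal{E}-\mathcal{V}$. -}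

module Defs where

open import Data.Nat as ℕ using (ℕ; zero; suc; _≤_; _<_; NonZero)
open import Data.Fin as Fin using (Fin; toℕ)
open import Data.Fin.Properties using (_≟_)
open import Data.Bool using (Bool; true; false; not; if_then_else_; _∧_; _∨_)
open import Data.Product using (_×_; _,_; proj₁; proj₂; ∃; ∃-syntax; Σ)
open import Data.List using (List; []; _∷_; map; _++_; allFin; foldr)
open import Data.Integer as ℤ using (ℤ; +_)
open import Data.Rational as ℚ using (ℚ; _/_)
open import Relation.Nullary using (does)
open import Relation.Binary.PropositionalEquality using (_≡_)
open import Relation.Binary.Construct.Closure.ReflexiveTransitive using (Star)
open import Function.Bundles using (_⇔_)
open import Data.Unit using (⊤)

-- Darts (half-edges) of a map with E edges: edge e has darts (e , false), (e , true).
Dart : ℕ → Set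
Dart E = Fin E × Bool

α : ∀ {E} → Dart E → Dart E
α (e , b) = (e , not b)

-- linear order key on darts (used to pick a canonical representative of an orbit)
key : ∀ {E} → Dart E → ℕ
key (e , false) = 2 ℕ.* toℕ e
key (e , true)  = suc (2 ℕ.* toℕ e)

allDarts : (E : ℕ) → List (Dart E)
allDarts E = map (λ e → (e , false)) (allFin E) ++ map (λ e → (e , true)) (allFin E)

iter : ∀ {A : Set} → ℕ → (A → A) → A → A
iter zero    f x = x
iter (suc k) f x = f (iter k f x)

count : ∀ {A : Set} → (A → Bool) → List A → ℕ
count p = foldr (λ x n → if p x then suc n else n) 0

anyL : ∀ {A : Set} → (A → Bool) → List A → Bool
anyL p = foldr (λ x b → p x ∨ b) false

allBelow : ℕ → (ℕ → Bool) → Bool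
allBelow zero    p = true
allBelow (suc n) p = allBelow n p ∧ p n

-- An edge-colored combinatorial map with colors in [D] = Fin D (no cilia).
-- Vertices Fin V, edges Fin E, each dart attached to a vertex; σ is the rotation
-- (a permutation of the darts whose cycles are exactly the darts around each vertex).
record ColMap (D : ℕ) : Set where
  field
    V E    : ℕ
    color  : Fin E → Fin D
    vert   : Dart E → Fin V
    σ      : Dart E → Dart E
    σ⁻¹    : Dart E → Dart E
    σ-inv₁ : ∀ d → σ (σ⁻¹ d) ≡ d
    σ-inv₂ : ∀ d → σ⁻¹ (σ d) ≡ d
    σ-vert : ∀ d → vert (σ d) ≡ vert d
    σ-cyc  : ∀ d d' → vert d ≡ vert d' → ∃[ k ] iter k σ d ≡ d'

module _ {D : ℕ} (M : ColMap D) where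
  open ColMap M

  dartColor : Dart E → Fin D
  dartColor (e , _) = color e

  nE : ℕ
  nE = E

  nV : ℕ
  nV = V

  Adj : (Fin E → Set) → Fin V → Fin V → Set
  Adj P u v = Σ (Dart E) λ d → P (proj₁ d) × (vert d ≡ u) × (vert (α d) ≡ v)

  Connected : Set
  Connected = ∀ u v → Star (Adj (λ _ → ⊤)) u v

  isCol : Fin D → Dart E → Bool
  isCol i d = does (dartColor d ≟ i)

  nEcol : Fin D → ℕ
  nEcol i = count (λ e → does (color e ≟ i)) (allFin E)

  -- induced rotation on darts of color i: next dart of color i around the vertex
  nextCol : Fin D → ℕ → Dart E → Dart E
  nextCol i zero    d = d
  nextCol i (suc n) d = if isCol i (σ d) then σ d else nextCol i n (σ d)

  σcol : Fin D → Dart E → Dart E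
  σcol i = nextCol i (2 ℕ.* E)

  φcol : Fin D → Dart E → Dart E
  φcol i d = σcol i (α d)

  faceRep : Fin D → Dart E → Bool
  faceRep i d = isCol i d ∧ allBelow (2 ℕ.* E) (λ k → key d ℕ.≤ᵇ key (iter k (φcol i) d))

  isolated : Fin D → Fin V → Bool
  isolated i v = not (anyL (λ d → isCol i d ∧ does (vert d ≟ v)) (allDarts E))

  -- number of faces of M^(i); an isolated vertex counts as one face
  nFcol : Fin D → ℕ
  nFcol i = count (faceRep i) (allDarts E) ℕ.+ count (isolated i) (allFin V)

  -- connected components of M^(i): k is their number, witnessed by a surjective
  -- labelling of the vertices whose fibres are exactly the components
  record ComponentCount (i : Fin D) (k : ℕ) : Set where
    field
      label : Fin V → Fin k
      surj  : ∀ c → ∃[ v ] label v ≡ c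
      fibre : ∀ u v → (label u ≡ label v) ⇔ Star (Adj (λ e → color e ≡ i)) u v

sumFin : ∀ {A : Set} → (A → A → A) → A → (n : ℕ) → (Fin n → A) → A
sumFin _⊕_ z zero    f = z
sumFin _⊕_ z (suc n) f = f Fin.zero ⊕ sumFin _⊕_ z n (λ j → f (Fin.suc j))

nF : ∀ {D} → ColMap D → ℕ
nF {D} M = sumFin ℕ._+_ 0 D (nFcol M)

ℕ→ℚ : ℕ → ℚ
ℕ→ℚ n = + n / 1

ℤ→ℚ : ℤ → ℚ
ℤ→ℚ z = z / 1

δ : ∀ {D} → ColMap D → ℚ
δ {D} M = ℕ→ℚ (nF M) ℚ.- (ℕ→ℚ D ℚ.- ℚ.1ℚ) ℚ.* ℕ→ℚ (nE M)

circ : ∀ {D} → ColMap D → ℚ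
circ M = ℕ→ℚ (nE M) ℚ.- ℕ→ℚ (nV M) ℚ.+ ℚ.1ℚ

circCol : ∀ {D} → ColMap D → Fin D → ℕ → ℚ
circCol M i k = ℕ→ℚ (nEcol M i) ℚ.- ℕ→ℚ (nV M) ℚ.+ ℕ→ℚ k

-- genus of M^(i), defined by F = 2k - 2g + E - V, i.e. g = (2k + E - V - F)/2
genusCol : ∀ {D} → ColMap D → Fin D → ℕ → ℚ
genusCol M i k =
  (ℤ.+ (2 ℕ.* k ℕ.+ nEcol M i) ℤ.- ℤ.+ (nV M ℕ.+ nFcol M i)) / 2

module Submission where

-- Write V, E, F for the vertices, edges and faces of M, and E_i, F_i, k_i,
-- l_i, g_i for the edges, faces, components, circuit rank and genus of M^(i).
--
--  * Per colour, the definitions l_i = E_i - V + k_i and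
--    2 g_i = 2 k_i + E_i - V - F_i give  2 (l_i - g_i) + V = E_i + F_i.
--  * Every edge carries exactly one colour, so  Σ_i E_i = E,  and by definition
--    Σ_i F_i = F.  Summing the previous identity over the D colours therefore
--    gives  2 Σ_i (l_i - g_i) + D V = E + F.
--  * Since  D (1 - l) = D V - D E,  the right-hand side of the theorem is
--    D V - D E + E + F - D V = F - (D - 1) E = δ(M).

open import Defs
open import Level using (0ℓ)
open import Algebra.Bundles using (Semiring; CommutativeRing)
open import Data.Nat as ℕ using (ℕ; zero; suc; _≤_; _>_)
open import Data.Integer as ℤ using (+_)
open import Data.Fin as Fin using (Fin)
open import Data.Fin.Properties using (_≟_)
open import Data.Bool using (Bool; true; false; if_then_else_)
open import Data.List using (List; []; _∷_; length; allFin)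
open import Data.List.Properties using (length-tabulate)
open import Data.Rational as ℚ using (ℚ; 1ℚ; toℚᵘ)
open import Data.Rational.Properties as ℚP
  using (toℚᵘ-injective; toℚᵘ-fromℚᵘ; toℚᵘ-homo-+; toℚᵘ-homo‿-; toℚᵘ-homo-*)
import Data.Rational.Unnormalised as ℚᵘ
import Data.Rational.Unnormalised.Properties as ℚᵘP
import Data.Integer.Properties as ℤP
open import Data.Integer.Solver using (module +-*-Solver)
open import Data.Rational.Solver renaming (module +-*-Solver to ℚ-Solver)
import Data.Nat.Properties as ℕP
open import Relation.Nullary using (does)
open import Relation.Binary.PropositionalEquality
  using (_≡_; refl; sym; trans; cong; cong₂; module ≡-Reasoning)
import Relation.Binary.Reasoning.Setoid as SetoidReasoning

module FinSum {ℓ} (R : Semiring 0ℓ ℓ) where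
  open Semiring R renaming (refl to ≈-refl; sym to ≈-sym; trans to ≈-trans)
  open SetoidReasoning setoid

  Σ : (n : ℕ) → (Fin n → Carrier) → Carrier
  Σ = sumFin _+_ 0#

  Σ-cong : ∀ n {f g : Fin n → Carrier} → (∀ i → f i ≈ g i) → Σ n f ≈ Σ n g
  Σ-cong zero    f≈g = ≈-refl
  Σ-cong (suc n) f≈g = +-cong (f≈g Fin.zero) (Σ-cong n (λ i → f≈g (Fin.suc i)))

  Σ-0 : ∀ n → Σ n (λ _ → 0#) ≈ 0#
  Σ-0 zero    = ≈-refl
  Σ-0 (suc n) = ≈-trans (+-congˡ (Σ-0 n)) (+-identityˡ 0#)

  Σ-+ : ∀ n (f g : Fin n → Carrier) → Σ n (λ i → f i + g i) ≈ Σ n f + Σ n g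
  Σ-+ zero    f g = ≈-sym (+-identityˡ 0#)
  Σ-+ (suc n) f g = begin
    (f₀ + g₀) + Σ n (λ i → f (Fin.suc i) + g (Fin.suc i)) ≈⟨ +-congˡ (Σ-+ n _ _) ⟩
    (f₀ + g₀) + (F + G)                                   ≈⟨ +-assoc f₀ g₀ (F + G) ⟩
    f₀ + (g₀ + (F + G))                                   ≈⟨ +-congˡ (x∙yz≈y∙xz g₀ F G) ⟩
    f₀ + (F + (g₀ + G))                                   ≈⟨ +-assoc f₀ F (g₀ + G) ⟨
    (f₀ + F) + (g₀ + G)                                   ∎
    where f₀ = f Fin.zero
          g₀ = g Fin.zero
          F  = Σ n (λ i → f (Fin.suc i))
          G  = Σ n (λ i → g (Fin.suc i))
          open import Algebra.Properties.CommutativeSemigroup +-commutativeSemigroup using (x∙yz≈y∙xz)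

  Σ-*ˡ : ∀ n a (f : Fin n → Carrier) → a * Σ n f ≈ Σ n (λ i → a * f i)
  Σ-*ˡ zero    a f = zeroʳ a
  Σ-*ˡ (suc n) a f = ≈-trans (distribˡ a (f Fin.zero) _) (+-congˡ (Σ-*ˡ n a (λ i → f (Fin.suc i))))

module ℕΣ = FinSum ℕP.+-*-semiring

𝟙 : Bool → ℕ
𝟙 b = if b then 1 else 0

count-∷ : ∀ {A : Set} (p : A → Bool) x (L : List A) → count p (x ∷ L) ≡ 𝟙 (p x) ℕ.+ count p L
count-∷ p x L with p x
... | true  = refl
... | false = refl

Σ-indicator : ∀ {D} (x : Fin D) → ℕΣ.Σ D (λ i → 𝟙 (does (x ≟ i))) ≡ 1
Σ-indicator {suc D} Fin.zero    = cong suc (ℕΣ.Σ-0 D)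
Σ-indicator {suc D} (Fin.suc x) = Σ-indicator x

Σ-colour-classes : ∀ {A : Set} D (c : A → Fin D) (L : List A) →
  ℕΣ.Σ D (λ i → count (λ x → does (c x ≟ i)) L) ≡ length L
Σ-colour-classes D c []      = ℕΣ.Σ-0 D
Σ-colour-classes D c (x ∷ L) = begin
  ℕΣ.Σ D (λ i → count (class i) (x ∷ L))                   ≡⟨ ℕΣ.Σ-cong D (λ i → count-∷ (class i) x L) ⟩
  ℕΣ.Σ D (λ i → 𝟙 (class i x) ℕ.+ count (class i) L)       ≡⟨ ℕΣ.Σ-+ D _ _ ⟩
  ℕΣ.Σ D (λ i → 𝟙 (class i x)) ℕ.+ ℕΣ.Σ D (λ i → count (class i) L)
                                                            ≡⟨ cong₂ ℕ._+_ (Σ-indicator (c x)) (Σ-colour-classes D c L) ⟩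
  suc (length L)                                            ∎
  where class : Fin D → _ → Bool
        class i y = does (c y ≟ i)
        open ≡-Reasoning

-- Every edge has exactly one colour:  Σ_i E(M^(i)) = E(M).
Σ-nEcol : ∀ {D} (M : ColMap D) → ℕΣ.Σ D (nEcol M) ≡ nE M
Σ-nEcol {D} M = trans (Σ-colour-classes D (ColMap.color M) (allFin (nE M)))
                      (length-tabulate {n = nE M} (λ e → e))

open import Data.Rational using (_+_; _-_; _*_)

-- Casts into ℚ.  The facts below are checked on unnormalised
-- representatives, where they become ring identities in ℤ.

toℚᵘ-ℕ→ℚ : ∀ n → toℚᵘ (ℕ→ℚ n) ℚᵘ.≃ ℚᵘ.mkℚᵘ (+ n) 0
toℚᵘ-ℕ→ℚ n = toℚᵘ-fromℚᵘ (ℚᵘ.mkℚᵘ (+ n) 0)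

toℚᵘ-half : ∀ z → toℚᵘ (z ℚ./ 2) ℚᵘ.≃ ℚᵘ.mkℚᵘ z 1
toℚᵘ-half z = toℚᵘ-fromℚᵘ (ℚᵘ.mkℚᵘ z 1)

ℕ→ℚ-+ : ∀ m n → ℕ→ℚ (m ℕ.+ n) ≡ ℕ→ℚ m + ℕ→ℚ n
ℕ→ℚ-+ m n = toℚᵘ-injective (begin
    toℚᵘ (ℕ→ℚ (m ℕ.+ n))                ≈⟨ toℚᵘ-ℕ→ℚ (m ℕ.+ n) ⟩
    ℚᵘ.mkℚᵘ (+ (m ℕ.+ n)) 0             ≈⟨ ℚᵘP.≃-reflexive (cong (λ z → ℚᵘ.mkℚᵘ z 0) (ℤP.pos-+ m n)) ⟩
    ℚᵘ.mkℚᵘ (+ m ℤ.+ + n) 0             ≈⟨ ℚᵘ.*≡* (solve 2 (λ a b →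
                                              (a :+ b) :* (con (+ 1) :* con (+ 1))
                                                := (a :* con (+ 1) :+ b :* con (+ 1)) :* con (+ 1))
                                              refl (+ m) (+ n)) ⟩
    ℚᵘ.mkℚᵘ (+ m) 0 ℚᵘ.+ ℚᵘ.mkℚᵘ (+ n) 0 ≈⟨ ℚᵘP.+-cong (ℚᵘP.≃-sym (toℚᵘ-ℕ→ℚ m)) (ℚᵘP.≃-sym (toℚᵘ-ℕ→ℚ n)) ⟩
    toℚᵘ (ℕ→ℚ m) ℚᵘ.+ toℚᵘ (ℕ→ℚ n)     ≈⟨ toℚᵘ-homo-+ (ℕ→ℚ m) (ℕ→ℚ n) ⟨
    toℚᵘ (ℕ→ℚ m + ℕ→ℚ n)                ∎)
  where open ℚᵘP.≃-Reasoning
        open +-*-Solver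

ℕ→ℚ-* : ∀ m n → ℕ→ℚ (m ℕ.* n) ≡ ℕ→ℚ m * ℕ→ℚ n
ℕ→ℚ-* m n = toℚᵘ-injective (begin
    toℚᵘ (ℕ→ℚ (m ℕ.* n))                ≈⟨ toℚᵘ-ℕ→ℚ (m ℕ.* n) ⟩
    ℚᵘ.mkℚᵘ (+ (m ℕ.* n)) 0             ≈⟨ ℚᵘP.≃-reflexive (cong (λ z → ℚᵘ.mkℚᵘ z 0) (ℤP.pos-* m n)) ⟩
    ℚᵘ.mkℚᵘ (+ m ℤ.* + n) 0             ≈⟨ ℚᵘ.*≡* (solve 2 (λ a b →
                                              (a :* b) :* (con (+ 1) :* con (+ 1)) := (a :* b) :* con (+ 1))
                                              refl (+ m) (+ n)) ⟩
    ℚᵘ.mkℚᵘ (+ m) 0 ℚᵘ.* ℚᵘ.mkℚᵘ (+ n) 0 ≈⟨ ℚᵘP.*-cong (ℚᵘP.≃-sym (toℚᵘ-ℕ→ℚ m)) (ℚᵘP.≃-sym (toℚᵘ-ℕ→ℚ n)) ⟩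
    toℚᵘ (ℕ→ℚ m) ℚᵘ.* toℚᵘ (ℕ→ℚ n)     ≈⟨ toℚᵘ-homo-* (ℕ→ℚ m) (ℕ→ℚ n) ⟨
    toℚᵘ (ℕ→ℚ m * ℕ→ℚ n)                ∎)
  where open ℚᵘP.≃-Reasoning
        open +-*-Solver

double-half : ∀ m n → ℕ→ℚ 2 * ((+ m ℤ.- + n) ℚ./ 2) ≡ ℕ→ℚ m - ℕ→ℚ n
double-half m n = toℚᵘ-injective (begin
    toℚᵘ (ℕ→ℚ 2 * h)                          ≈⟨ toℚᵘ-homo-* (ℕ→ℚ 2) h ⟩
    toℚᵘ (ℕ→ℚ 2) ℚᵘ.* toℚᵘ h                 ≈⟨ ℚᵘP.*-cong (toℚᵘ-ℕ→ℚ 2) (toℚᵘ-half (+ m ℤ.- + n)) ⟩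
    ℚᵘ.mkℚᵘ (+ 2) 0 ℚᵘ.* ℚᵘ.mkℚᵘ (+ m ℤ.- + n) 1 ≈⟨ ℚᵘ.*≡* (solve 2 (λ a b →
                                                    (con (+ 2) :* (a :- b)) :* (con (+ 1) :* con (+ 1))
                                                      := (a :* con (+ 1) :+ (:- b) :* con (+ 1)) :* (con (+ 1) :* con (+ 2)))
                                                    refl (+ m) (+ n)) ⟩
    ℚᵘ.mkℚᵘ (+ m) 0 ℚᵘ.- ℚᵘ.mkℚᵘ (+ n) 0      ≈⟨ ℚᵘP.+-cong (ℚᵘP.≃-sym (toℚᵘ-ℕ→ℚ m))
                                                     (ℚᵘP.-‿cong (ℚᵘP.≃-sym (toℚᵘ-ℕ→ℚ n))) ⟩
    toℚᵘ (ℕ→ℚ m) ℚᵘ.- toℚᵘ (ℕ→ℚ n)           ≈⟨ ℚᵘP.+-congʳ (toℚᵘ (ℕ→ℚ m)) (toℚᵘ-homo‿- (ℕ→ℚ n)) ⟨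
    toℚᵘ (ℕ→ℚ m) ℚᵘ.+ toℚᵘ (ℚ.- ℕ→ℚ n)      ≈⟨ toℚᵘ-homo-+ (ℕ→ℚ m) _ ⟨
    toℚᵘ (ℕ→ℚ m - ℕ→ℚ n)                     ∎)
  where h = (+ m ℤ.- + n) ℚ./ 2
        open ℚᵘP.≃-Reasoning
        open +-*-Solver

module ℚΣ = FinSum (CommutativeRing.semiring ℚP.+-*-commutativeRing)

ℕ→ℚ-Σ : ∀ n (f : Fin n → ℕ) → ℕ→ℚ (ℕΣ.Σ n f) ≡ ℚΣ.Σ n (λ i → ℕ→ℚ (f i))
ℕ→ℚ-Σ zero    f = refl
ℕ→ℚ-Σ (suc n) f = trans (ℕ→ℚ-+ (f Fin.zero) _) (cong (λ s → ℕ→ℚ (f Fin.zero) + s) (ℕ→ℚ-Σ n (λ i → f (Fin.suc i))))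

ℚΣ-const : ∀ n a → ℚΣ.Σ n (λ _ → a) ≡ ℕ→ℚ n * a
ℚΣ-const zero    a = sym (ℚP.*-zeroˡ a)
ℚΣ-const (suc n) a = begin
  a + ℚΣ.Σ n (λ _ → a)       ≡⟨ cong (λ s → a + s) (ℚΣ-const n a) ⟩
  a + ℕ→ℚ n * a              ≡⟨ cong (_+ ℕ→ℚ n * a) (ℚP.*-identityˡ a) ⟨
  1ℚ * a + ℕ→ℚ n * a         ≡⟨ ℚP.*-distribʳ-+ a 1ℚ (ℕ→ℚ n) ⟨
  (1ℚ + ℕ→ℚ n) * a           ≡⟨ cong (_* a) (ℕ→ℚ-+ 1 n) ⟨
  ℕ→ℚ (suc n) * a            ∎
  where open ≡-Reasoning

colour-identity : ∀ {D} (M : ColMap D) i k →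
  ℕ→ℚ 2 * (circCol M i k - genusCol M i k) + ℕ→ℚ (nV M) ≡ ℕ→ℚ (nEcol M i) + ℕ→ℚ (nFcol M i)
colour-identity M i k = begin
  two * (circCol M i k - g) + V                          ≡⟨ ℚ-Solver.solve 3 (λ l g v →
                                                              con two :* (l :- g) :+ v := con two :* l :- con two :* g :+ v)
                                                              refl (circCol M i k) g V ⟩
  two * (Eᵢ - V + K) - two * g + V                       ≡⟨ cong (λ x → two * (Eᵢ - V + K) - x + V)
                                                              (double-half (2 ℕ.* k ℕ.+ nEcol M i) (nV M ℕ.+ nFcol M i)) ⟩
  two * (Eᵢ - V + K) - (ℕ→ℚ (2 ℕ.* k ℕ.+ nEcol M i) - ℕ→ℚ (nV M ℕ.+ nFcol M i)) + V
                                                         ≡⟨ cong₂ (λ x y → two * (Eᵢ - V + K) - (x - y) + V)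
                                                              (trans (ℕ→ℚ-+ (2 ℕ.* k) (nEcol M i)) (cong (_+ Eᵢ) (ℕ→ℚ-* 2 k)))
                                                              (ℕ→ℚ-+ (nV M) (nFcol M i)) ⟩
  two * (Eᵢ - V + K) - (two * K + Eᵢ - (V + Fᵢ)) + V     ≡⟨ ℚ-Solver.solve 4 (λ e v κ f →
                                                              con two :* (e :- v :+ κ) :- (con two :* κ :+ e :- (v :+ f)) :+ v
                                                                := e :+ f)
                                                              refl Eᵢ V K Fᵢ ⟩
  Eᵢ + Fᵢ                                                ∎
  where two = ℕ→ℚ 2
        g   = genusCol M i k
        V   = ℕ→ℚ (nV M)
        K   = ℕ→ℚ k
        Eᵢ  = ℕ→ℚ (nEcol M i)
        Fᵢ  = ℕ→ℚ (nFcol M i)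
        open ≡-Reasoning
        open ℚ-Solver using (con; _:+_; _:-_; _:*_; _:=_)

coloured-sum : ∀ {D} (M : ColMap D) (k : Fin D → ℕ) →
  ℕ→ℚ 2 * ℚΣ.Σ D (λ i → circCol M i (k i) - genusCol M i (k i)) + ℕ→ℚ D * ℕ→ℚ (nV M)
    ≡ ℕ→ℚ (nE M) + ℕ→ℚ (nF M)
coloured-sum {D} M k = begin
  ℕ→ℚ 2 * ℚΣ.Σ D d + ℕ→ℚ D * V                ≡⟨ cong₂ _+_ (ℚΣ.Σ-*ˡ D (ℕ→ℚ 2) d) (sym (ℚΣ-const D V)) ⟩
  ℚΣ.Σ D (λ i → ℕ→ℚ 2 * d i) + ℚΣ.Σ D (λ _ → V) ≡⟨ ℚΣ.Σ-+ D _ _ ⟨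
  ℚΣ.Σ D (λ i → ℕ→ℚ 2 * d i + V)              ≡⟨ ℚΣ.Σ-cong D (λ i → colour-identity M i (k i)) ⟩
  ℚΣ.Σ D (λ i → ℕ→ℚ (nEcol M i) + ℕ→ℚ (nFcol M i))
                                               ≡⟨ ℚΣ.Σ-+ D _ _ ⟩
  ℚΣ.Σ D (λ i → ℕ→ℚ (nEcol M i)) + ℚΣ.Σ D (λ i → ℕ→ℚ (nFcol M i))
                                               ≡⟨ cong₂ _+_ (ℕ→ℚ-Σ D (nEcol M)) (ℕ→ℚ-Σ D (nFcol M)) ⟨
  ℕ→ℚ (ℕΣ.Σ D (nEcol M)) + ℕ→ℚ (nF M)         ≡⟨ cong (λ x → ℕ→ℚ x + ℕ→ℚ (nF M)) (Σ-nEcol M) ⟩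
  ℕ→ℚ (nE M) + ℕ→ℚ (nF M)                     ∎
  where d : Fin D → ℚ
        d i = circCol M i (k i) - genusCol M i (k i)
        V = ℕ→ℚ (nV M)
        open ≡-Reasoning

-- Proposition 4.
proposition4 : (D : ℕ) → 2 ≤ D → (M : ColMap D) → nV M > 0 → Connected M →
    (k : Fin D → ℕ) → (∀ i → ComponentCount M i (k i)) →
    δ M ≡ ℕ→ℚ D * (1ℚ - circ M)
          + ℕ→ℚ 2 * sumFin _+_ (ℕ→ℚ 0) D (λ i → circCol M i (k i) - genusCol M i (k i))
proposition4 D _ M _ _ k _ = begin
  F - (Dq - 1ℚ) * E                         ≡⟨ solve 4 (λ d e v f →
                                                  f :- (d :- con 1ℚ) :* e
                                                    := d :* (con 1ℚ :- (e :- v :+ con 1ℚ)) :+ ((e :+ f) :- d :* v))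
                                                  refl Dq E V F ⟩
  Dq * (1ℚ - circ M) + ((E + F) - Dq * V)  ≡⟨ cong (λ x → Dq * (1ℚ - circ M) + (x - Dq * V)) (coloured-sum M k) ⟨
  Dq * (1ℚ - circ M) + ((two * S + Dq * V) - Dq * V)
                                            ≡⟨ cong (λ x → Dq * (1ℚ - circ M) + x)
                                                 (solve 2 (λ x y → (x :+ y) :- y := x) refl (two * S) (Dq * V)) ⟩
  Dq * (1ℚ - circ M) + two * S              ∎
  where Dq  = ℕ→ℚ D
        E   = ℕ→ℚ (nE M)
        V   = ℕ→ℚ (nV M)
        F   = ℕ→ℚ (nF M)
        two = ℕ→ℚ 2
        S   = ℚΣ.Σ D (λ i → circCol M i (k i) - genusCol M i (k i))
        open ≡-Reasoning
        open ℚ-Solver
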